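{- Let $\mathcal S$ be one of the four step sets simple, diagonal, king, diabolo. For every $(a,b)\in\mathcal C$, \[ P^{a,b}(x,y)=\bar x\big(L^{a,b}(x,y)-L^{a,b}(0,y)\big)+\bar y\big(B^{a,b}(x,y)-B^{a,b}(x,0)\big)+\begin{cases}Q^{a,b}(x,y)&\text{if }a,b\ge0,\\0&\text{if }a=-1\text{ or }b=-1,\\-Q^{ -a-2,b}(x,y)&\text{if }a<-1,\\-Q^{a,-b-2}(x,y)&\text{if }b<-1.\end{cases} \]
   Context: The four step sets are: simple $\{(1,0),(0,1),(-1,0),(0,-1)\}$; diagonal $\{(1,1),(-1,1),(-1,-1),(1,-1)\}$; king $\{ -1,0,1\}^2\setminus\{(0,0)\}$; diabolo $\{(1,0),(1,1),(-1,1),(-1,0),(-1,-1),(1,-1)\}$. $\mathcal Q=\{(i,j):i\ge0,j\ge0\}$, $\mathcal C=\{(i,j)\in\mathbb Z^2:i\ge0\text{ or }j\ge0\}$. A walk is confined to $\mathcal C$ if all its vertices lie in $\mathcal C$ and it uses no step between $(-1,0)$ and $(0,-1)$. $\bar x=1/x$, $\bar y=1/y$. $C^{a,b}_{i,j}$ (resp. $Q^{a,b}_{i,j}$) is the length generating function (variable $t$) of walks from $(a,b)$ to $(i,j)$ confined to $\mathcal C$ (resp. with all vertices in $\mathcal Q$). $C^{a,b}(x,y)=\sum_{(i,j)\in\mathcal C}C^{a,b}_{i,j}x^iy^j$, $Q^{a,b}(x,y)=\sum_{(i,j)\in\mathcal Q}Q^{a,b}_{i,j}x^iy^j$. The series $P^{a,b},L^{a,b},B^{a,b}\in\mathbb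 Q[x,y][[t]]$ are uniquely defined by $C^{a,b}(x,y)=P^{a,b}(x,y)+\bar xL^{a,b}(\bar x,y)+\bar yB^{a,b}(x,\bar y)$. -}

module Defs where

open import Data.Bool using (Bool; true; false; _∧_; _∨_; not)
open import Data.Nat using (ℕ; zero; suc)
open import Data.Integer using (ℤ; +_; -[1+_]; _+_; _≤ᵇ_; 0ℤ; 1ℤ; -1ℤ)
open import Data.Integer.Properties using (_≟_)
open import Data.List using (List; []; _∷_; map; concatMap; filter; length)
open import Data.Product using (_×_; _,_)
open import Relation.Nullary using (does)
open import Relation.Nullary.Decidable using (T?)

Pt : Set
Pt = ℤ × ℤ

_+ₚ_ : Pt → Pt → Pt
(a , b) +ₚ (c , d) = (a + c , b + d)

_==ₚ_ : Pt → Pt → Bool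
(a , b) ==ₚ (c , d) = does (a ≟ c) ∧ does (b ≟ d)

data StepSet : Set where
  simple diagonal king diabolo : StepSet

steps : StepSet → List Pt
steps simple   = (1ℤ , 0ℤ) ∷ (0ℤ , 1ℤ) ∷ (-1ℤ , 0ℤ) ∷ (0ℤ , -1ℤ) ∷ []
steps diagonal = (1ℤ , 1ℤ) ∷ (-1ℤ , 1ℤ) ∷ (-1ℤ , -1ℤ) ∷ (1ℤ , -1ℤ) ∷ []
steps king     = (1ℤ , 0ℤ) ∷ (1ℤ , 1ℤ) ∷ (0ℤ , 1ℤ) ∷ (-1ℤ , 1ℤ)
               ∷ (-1ℤ , 0ℤ) ∷ (-1ℤ , -1ℤ) ∷ (0ℤ , -1ℤ) ∷ (1ℤ , -1ℤ) ∷ []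
steps diabolo  = (1ℤ , 0ℤ) ∷ (1ℤ , 1ℤ) ∷ (-1ℤ , 1ℤ) ∷ (-1ℤ , 0ℤ)
               ∷ (-1ℤ , -1ℤ) ∷ (1ℤ , -1ℤ) ∷ []

inC : Pt → Bool
inC (i , j) = (0ℤ ≤ᵇ i) ∨ (0ℤ ≤ᵇ j)

inQ : Pt → Bool
inQ (i , j) = (0ℤ ≤ᵇ i) ∧ (0ℤ ≤ᵇ j)

forbidden : Pt → Pt → Bool
forbidden p q = ((p ==ₚ (-1ℤ , 0ℤ)) ∧ (q ==ₚ (0ℤ , -1ℤ)))
              ∨ ((p ==ₚ (0ℤ , -1ℤ)) ∧ (q ==ₚ (-1ℤ , 0ℤ)))

-- A walk from p is given by its list of steps.
endpoint : Pt → List Pt → Pt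
endpoint p []       = p
endpoint p (s ∷ ss) = endpoint (p +ₚ s) ss

confinedC : Pt → List Pt → Bool
confinedC p []       = inC p
confinedC p (s ∷ ss) = inC p ∧ not (forbidden p (p +ₚ s)) ∧ confinedC (p +ₚ s) ss

confinedQ : Pt → List Pt → Bool
confinedQ p []       = inQ p
confinedQ p (s ∷ ss) = inQ p ∧ confinedQ (p +ₚ s) ss

words : List Pt → ℕ → List (List Pt)
words S zero    = [] ∷ []
words S (suc n) = concatMap (λ s → map (s ∷_) (words S n)) S

-- Number of walks of length n with steps in S from p to q confined to 𝒞
-- (= coefficient of t^n in C^{p}_{q}).
countC : StepSet → ℕ → Pt → Pt → ℕ
countC S n p q =
  length (filter (λ w → T? (confinedC p w ∧ (endpoint p w ==ₚ q))) (words (steps S) n))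

-- Same for walks with all vertices in 𝒬 (= coefficient of t^n in Q^{p}_{q}).
countQ : StepSet → ℕ → Pt → Pt → ℕ
countQ S n p q =
  length (filter (λ w → T? (confinedQ p w ∧ (endpoint p w ==ₚ q))) (words (steps S) n))

{-# OPTIONS --safe #-}
-- Fix a target t in the quadrant, let σˣ, σʸ be the reflections in the lines x = -1 and y = -1,
-- and compare, as functions of the start point p,
--   signedC n t p = C_n(p → t) - C_n(p → σˣ t) - C_n(p → σʸ t),
--   signedQ n t p = Q_n(p → t) - Q_n(σˣ p → t) - Q_n(σʸ p → t).
-- Both satisfy the first-step recurrence of walks confined to 𝒞 and agree for n = 0, so they are
-- equal. For signedQ this is a reflection principle: the step sets are invariant under x ↦ -x and
-- y ↦ -y, so reflecting commutes with taking a step, and signedQ vanishes at both ends (-1,0),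
-- (0,-1) of the forbidden step. Evaluating signedQ at the start point gives the four cases.
module Submission where

open import Defs
open import Data.Bool using (Bool; true; false; T; if_then_else_; _∧_; not)
open import Data.Bool.Properties using (∧-zeroʳ; ∧-identityʳ; T-∧; T-∨; T-≡)
open import Data.Integer
  using (ℤ; +_; -[1+_]; _+_; _-_; -_; _≤_; _<_; _≤ᵇ_; 0ℤ; 1ℤ; -1ℤ; +≤+; -<-)
import Data.Integer.Properties as ℤ
open import Data.Integer.Tactic.RingSolver using (solve-∀)
open import Data.List using (List; []; _∷_; _++_; map; filter; length; foldr; concatMap)
open import Data.List.Properties using (filter-++; length-++; map-∘; map-cong)
open import Data.List.Relation.Binary.Permutation.Propositional
  using (_↭_; ↭-sym; ↭-trans; ↭-reflexive; ↭⇒↭ₛ)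
open import Data.List.Relation.Binary.Permutation.Propositional.Properties using (map⁺)
open import Data.List.Relation.Binary.Permutation.Setoid.Properties using (foldr-commMonoid)
open import Data.List.Relation.Unary.All using (All; []; _∷_; all?)
import Data.List.Relation.Unary.All as All
open import Data.Nat as ℕ using (ℕ; zero; suc; s≤s)
import Data.Nat.Properties as ℕ
open import Data.Product using (_×_; _,_; proj₂)
open import Data.Product.Relation.Binary.Lex.NonStrict using (×-decTotalOrder)
open import Data.Sum using (_⊎_; inj₁; inj₂)
open import Function using (_∘_; mk⇔; Equivalence)
open import Relation.Nullary using (Dec; yes; no; does; _×-dec_)
open import Relation.Nullary.Decidable using (True; T?; does-⇔; toWitness)
open import Relation.Binary.PropositionalEquality
open import Data.List.Sort.InsertionSort.Base (×-decTotalOrder ℤ.≤-decTotalOrder ℤ.≤-decTotalOrder)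
  using (sort)
open import Data.List.Sort.InsertionSort.Properties (×-decTotalOrder ℤ.≤-decTotalOrder ℤ.≤-decTotalOrder)
  using (sort-↭)

private
  variable
    A B : Set

-- Counting and summing over lists

count : (A → Bool) → List A → ℕ
count P xs = length (filter (T? ∘ P) xs)

count-++ : ∀ (P : A → Bool) xs ys → count P (xs ++ ys) ≡ count P xs ℕ.+ count P ys
count-++ P xs ys = trans (cong length (filter-++ (T? ∘ P) xs ys)) (length-++ (filter (T? ∘ P) xs))

count-map : ∀ (P : B → Bool) (f : A → B) xs → count P (map f xs) ≡ count (P ∘ f) xs
count-map P f [] = refl
count-map P f (x ∷ xs) with P (f x)
... | true  = cong suc (count-map P f xs)
... | false = count-map P f xs

count-singleton : ∀ (P : A → Bool) x → count P (x ∷ []) ≡ (if P x then 1 else 0)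
count-singleton P x with P x
... | true  = refl
... | false = refl

count-const-false : ∀ (xs : List A) → count (λ _ → false) xs ≡ 0
count-const-false []       = refl
count-const-false (x ∷ xs) = count-const-false xs

count-guard : ∀ c (X Y : A → Bool) xs →
  + count (λ x → (c ∧ X x) ∧ Y x) xs ≡ (if c then + count (λ x → X x ∧ Y x) xs else 0ℤ)
count-guard true  X Y xs = refl
count-guard false X Y xs = cong +_ (count-const-false xs)

∑ : List A → (A → ℤ) → ℤ
∑ xs f = foldr _+_ 0ℤ (map f xs)

∑-cong : ∀ (xs : List A) {f g : A → ℤ} → (∀ x → f x ≡ g x) → ∑ xs f ≡ ∑ xs g
∑-cong xs f≗g = cong (foldr _+_ 0ℤ) (map-cong f≗g xs)

∑-zero : ∀ {xs : List A} {f : A → ℤ} → All (λ x → f x ≡ 0ℤ) xs → ∑ xs f ≡ 0ℤ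
∑-zero []         = refl
∑-zero (fx≡0 ∷ ps) = cong₂ _+_ fx≡0 (∑-zero ps)

∑-if : ∀ c (xs : List A) f → ∑ xs (λ x → if c then f x else 0ℤ) ≡ (if c then ∑ xs f else 0ℤ)
∑-if true  xs       f = refl
∑-if false []       f = refl
∑-if false (x ∷ xs) f = trans (ℤ.+-identityˡ _) (∑-if false xs f)

∑-⊖ : ∀ (xs : List A) f g → ∑ xs (λ x → f x - g x) ≡ ∑ xs f - ∑ xs g
∑-⊖ []       f g = refl
∑-⊖ (x ∷ xs) f g = trans (cong (λ z → f x - g x + z) (∑-⊖ xs f g)) (interchange (f x) (g x) _ _)
  where
  interchange : ∀ a b c d → (a - b) + (c - d) ≡ (a + c) - (b + d)
  interchange = solve-∀

∑-↭ : ∀ {xs ys : List A} {f} → xs ↭ ys → ∑ xs f ≡ ∑ ys f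
∑-↭ {f = f} xs↭ys =
  foldr-commMonoid (setoid ℤ) ℤ.+-0-isCommutativeMonoid (↭⇒↭ₛ (map⁺ f xs↭ys))

∑-reindex : ∀ {xs : List A} {g : A → A} f → map g xs ↭ xs → ∑ xs (f ∘ g) ≡ ∑ xs f
∑-reindex {xs = xs} f gxs↭xs = trans (cong (foldr _+_ 0ℤ) (map-∘ xs)) (∑-↭ gxs↭xs)

if-⊖ : ∀ b x y → (if b then x - y else 0ℤ) ≡ (if b then x else 0ℤ) - (if b then y else 0ℤ)
if-⊖ true  x y = refl
if-⊖ false x y = refl

i-j-i≡-j : ∀ i j → i - j - i ≡ - j
i-j-i≡-j = solve-∀

i-i-j≡-j : ∀ i j → i - i - j ≡ - j
i-i-j≡-j = solve-∀

i≡[j+k]+[i-j-k] : ∀ i j k → i ≡ (j + k) + (i - j - k)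
i≡[j+k]+[i-j-k] = solve-∀

count-concatMap : ∀ (P : B → Bool) (g : A → List B) xs →
  + count P (concatMap g xs) ≡ ∑ xs (λ x → + count P (g x))
count-concatMap P g []       = refl
count-concatMap P g (x ∷ xs) = begin
  + count P (g x ++ concatMap g xs)                 ≡⟨ cong +_ (count-++ P (g x) _) ⟩
  + (count P (g x) ℕ.+ count P (concatMap g xs))    ≡⟨ ℤ.pos-+ (count P (g x)) _ ⟩
  + count P (g x) + + count P (concatMap g xs)
    ≡⟨ cong (λ z → + count P (g x) + z) (count-concatMap P g xs) ⟩
  ∑ (x ∷ xs) (λ x → + count P (g x))                ∎
  where open ≡-Reasoning

count-words-suc : ∀ (P : List Pt → Bool) L n →
  + count P (words L (suc n)) ≡ ∑ L (λ s → + count (P ∘ (s ∷_)) (words L n))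
count-words-suc P L n =
  trans (count-concatMap P (λ s → map (s ∷_) (words L n)) L)
        (∑-cong L (λ s → cong +_ (count-map P (s ∷_) (words L n))))

-- Reflections in the lines x = -1 and y = -1

-- mirror k = -k-2 is the reflection of ℤ in -1, written by cases so that it computes.
mirror : ℤ → ℤ
mirror (+ m)             = -[1+ suc m ]
mirror -[1+ zero ]       = -[1+ zero ]
mirror -[1+ suc k ]      = + k

mirror-≡ : ∀ x → mirror x ≡ - x - + 2
mirror-≡ (+ zero)        = refl
mirror-≡ (+ suc m)       = cong (λ k → -[1+ suc k ]) (ℕ.+-comm 1 m)
mirror-≡ -[1+ zero ]     = refl
mirror-≡ -[1+ suc k ]    = refl

mirror-involutive : ∀ x → mirror (mirror x) ≡ x
mirror-involutive (+ m)          = refl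
mirror-involutive -[1+ zero ]    = refl
mirror-involutive -[1+ suc k ]   = refl

mirror-+ : ∀ x c → mirror (x + c) ≡ mirror x - c
mirror-+ x c = begin
  mirror (x + c)      ≡⟨ mirror-≡ (x + c) ⟩
  - (x + c) - + 2     ≡⟨ regroup x c ⟩
  - x - + 2 - c       ≡⟨ cong (_- c) (mirror-≡ x) ⟨
  mirror x - c        ∎
  where
  open ≡-Reasoning
  regroup : ∀ x c → - (x + c) - + 2 ≡ - x - + 2 - c
  regroup = solve-∀

mirror-≟ : ∀ x y → does (x ℤ.≟ mirror y) ≡ does (mirror x ℤ.≟ y)
mirror-≟ x y = does-⇔ (mk⇔ to from) (x ℤ.≟ mirror y) (mirror x ℤ.≟ y)
  where
  to : x ≡ mirror y → mirror x ≡ y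
  to refl = mirror-involutive y
  from : mirror x ≡ y → x ≡ mirror y
  from refl = sym (mirror-involutive x)

σˣ σʸ negateˣ negateʸ : Pt → Pt
σˣ (x , y) = (mirror x , y)
σʸ (x , y) = (x , mirror y)
negateˣ (x , y) = (- x , y)
negateʸ (x , y) = (x , - y)

σˣ-+ₚ : ∀ p s → σˣ (p +ₚ s) ≡ σˣ p +ₚ negateˣ s
σˣ-+ₚ (x , y) (c , d) = cong (_, y + d) (mirror-+ x c)

σʸ-+ₚ : ∀ p s → σʸ (p +ₚ s) ≡ σʸ p +ₚ negateʸ s
σʸ-+ₚ (x , y) (c , d) = cong (x + c ,_) (mirror-+ y d)

==ₚ-sound : ∀ {p q} → T (p ==ₚ q) → p ≡ q
==ₚ-sound {a , b} {c , d} p==q with a ℤ.≟ c | b ℤ.≟ d | p==q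
... | yes refl | yes refl | _  = refl
... | no _     | _        | ()
... | yes _    | no _     | ()

==ₚ-σˣ : ∀ p q → (p ==ₚ σˣ q) ≡ (σˣ p ==ₚ q)
==ₚ-σˣ (x , y) (u , v) = cong (_∧ does (y ℤ.≟ v)) (mirror-≟ x u)

==ₚ-σʸ : ∀ p q → (p ==ₚ σʸ q) ≡ (σʸ p ==ₚ q)
==ₚ-σʸ (x , y) (u , v) = cong (does (x ℤ.≟ u) ∧_) (mirror-≟ y v)

∧-==ₚ : ∀ (P : Pt → Bool) {q} → T (P q) → ∀ p → P p ∧ (p ==ₚ q) ≡ (p ==ₚ q)
∧-==ₚ P {q} Pq p with p ==ₚ q in p==q
... | false = ∧-zeroʳ (P p)
... | true  = trans (∧-identityʳ (P p))
    (Equivalence.to T-≡ (subst (T ∘ P) (sym (==ₚ-sound (Equivalence.from T-≡ p==q))) Pq))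

forbidden-target : ∀ {p p'} → T (forbidden p p') → p' ≡ (0ℤ , -1ℤ) ⊎ p' ≡ (-1ℤ , 0ℤ)
forbidden-target {p} {p'} f
  with Equivalence.to (T-∨ {(p ==ₚ (-1ℤ , 0ℤ)) ∧ (p' ==ₚ (0ℤ , -1ℤ))}) f
... | inj₁ f₁ = inj₁ (==ₚ-sound (proj₂ (Equivalence.to (T-∧ {p ==ₚ (-1ℤ , 0ℤ)}) f₁)))
... | inj₂ f₂ = inj₂ (==ₚ-sound (proj₂ (Equivalence.to (T-∧ {p ==ₚ (0ℤ , -1ℤ)}) f₂)))

far+step≱0 : ∀ k {c} → c ≤ 1ℤ → (0ℤ ≤ᵇ (-[1+ suc k ] + c)) ≡ false
far+step≱0 k {+ zero}        _                = refl
far+step≱0 k {+ suc zero}    _                = refl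
far+step≱0 k {+ suc (suc m)} (+≤+ (s≤s ()))
far+step≱0 k { -[1+ m ]}     _                = refl

sort-≡⇒↭ : ∀ {xs ys : List Pt} → sort xs ≡ sort ys → xs ↭ ys
sort-≡⇒↭ {xs} {ys} eq = ↭-trans (↭-sym (sort-↭ xs)) (↭-trans (↭-reflexive eq) (sort-↭ ys))

-- Checked by computation: a step set and its reflection sort to the same list.
steps-symmetricˣ : ∀ S → map negateˣ (steps S) ↭ steps S
steps-symmetricˣ simple   = sort-≡⇒↭ refl
steps-symmetricˣ diagonal = sort-≡⇒↭ refl
steps-symmetricˣ king     = sort-≡⇒↭ refl
steps-symmetricˣ diabolo  = sort-≡⇒↭ refl

steps-symmetricʸ : ∀ S → map negateʸ (steps S) ↭ steps S
steps-symmetricʸ simple   = sort-≡⇒↭ refl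
steps-symmetricʸ diagonal = sort-≡⇒↭ refl
steps-symmetricʸ king     = sort-≡⇒↭ refl
steps-symmetricʸ diabolo  = sort-≡⇒↭ refl

Small : Pt → Set
Small (c , d) = c ≤ 1ℤ × d ≤ 1ℤ

steps-small : ∀ S → All Small (steps S)
steps-small S = toWitness {a? = all? small? (steps S)} (decided S)
  where
  small? : ∀ s → Dec (Small s)
  small? (c , d) = (c ℤ.≤? 1ℤ) ×-dec (d ℤ.≤? 1ℤ)
  decided : ∀ S → True (all? small? (steps S))
  decided simple   = _
  decided diagonal = _
  decided king     = _
  decided diabolo  = _

-- Walks and the reflection principle

module _ (S : StepSet) where

  -- The first step of a walk confined to 𝒞, as an operator on functions of the start point.
  transferC : (Pt → ℤ) → Pt → ℤ
  transferC F p =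
    if inC p then ∑ (steps S) (λ s → if not (forbidden p (p +ₚ s)) then F (p +ₚ s) else 0ℤ) else 0ℤ

  transferC-cong : ∀ {F G : Pt → ℤ} → F ≗ G → transferC F ≗ transferC G
  transferC-cong F≗G p = cong (λ z → if inC p then z else 0ℤ)
    (∑-cong (steps S) (λ s → cong (λ z → if not (forbidden p (p +ₚ s)) then z else 0ℤ)
                                  (F≗G (p +ₚ s))))

  transferC-⊖ : ∀ F G p → transferC (λ p' → F p' - G p') p ≡ transferC F p - transferC G p
  transferC-⊖ F G p = trans
    (cong (λ z → if inC p then z else 0ℤ)
      (trans (∑-cong (steps S) (λ s → if-⊖ (not (forbidden p (p +ₚ s))) _ _)) (∑-⊖ (steps S) _ _)))
    (if-⊖ (inC p) _ _)

  transferC-vanishing : ∀ F p → (∀ p' → T (forbidden p p') → F p' ≡ 0ℤ) →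
    transferC F p ≡ (if inC p then ∑ (steps S) (λ s → F (p +ₚ s)) else 0ℤ)
  transferC-vanishing F p vanish = cong (λ z → if inC p then z else 0ℤ)
    (∑-cong (steps S) (λ s → if-not (forbidden p (p +ₚ s)) (vanish (p +ₚ s))))
    where
    if-not : ∀ b {x} → (T b → x ≡ 0ℤ) → (if not b then x else 0ℤ) ≡ x
    if-not true  x≡0 = sym (x≡0 _)
    if-not false _   = refl

  transferC-unique : ∀ (F G : ℕ → Pt → ℤ) →
    (∀ n → F (suc n) ≗ transferC (F n)) → (∀ n → G (suc n) ≗ transferC (G n)) →
    F 0 ≗ G 0 → ∀ n → F n ≗ G n
  transferC-unique F G F-rec G-rec F₀≗G₀ zero    = F₀≗G₀
  transferC-unique F G F-rec G-rec F₀≗G₀ (suc n) p = begin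
    F (suc n) p          ≡⟨ F-rec n p ⟩
    transferC (F n) p    ≡⟨ transferC-cong (transferC-unique F G F-rec G-rec F₀≗G₀ n) p ⟩
    transferC (G n) p    ≡⟨ G-rec n p ⟨
    G (suc n) p          ∎
    where open ≡-Reasoning

  countC-zero : ∀ t p → countC S 0 p t ≡ (if inC p ∧ (p ==ₚ t) then 1 else 0)
  countC-zero t p = count-singleton (λ w → confinedC p w ∧ (endpoint p w ==ₚ t)) []

  countQ-zero : ∀ t r → countQ S 0 r t ≡ (if inQ r ∧ (r ==ₚ t) then 1 else 0)
  countQ-zero t r = count-singleton (λ w → confinedQ r w ∧ (endpoint r w ==ₚ t)) []

  countC-suc : ∀ n t p → + countC S (suc n) p t ≡ transferC (λ p' → + countC S n p' t) p
  countC-suc n t p = trans (count-words-suc _ (steps S) n)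
    (trans (∑-cong (steps S) first-step) (∑-if (inC p) (steps S) _))
    where
    ws : List (List Pt)
    ws = words (steps S) n
    first-step : ∀ s →
      + count (λ w → confinedC p (s ∷ w) ∧ (endpoint p (s ∷ w) ==ₚ t)) ws
      ≡ (if inC p then (if not (forbidden p (p +ₚ s)) then + countC S n (p +ₚ s) t else 0ℤ) else 0ℤ)
    first-step s = trans
      (count-guard (inC p) (λ w → not (forbidden p (p +ₚ s)) ∧ confinedC (p +ₚ s) w) reaches ws)
      (cong (λ z → if inC p then z else 0ℤ)
        (count-guard (not (forbidden p (p +ₚ s))) (confinedC (p +ₚ s)) reaches ws))
      where
      reaches : List Pt → Bool
      reaches w = endpoint (p +ₚ s) w ==ₚ t

  stepSumQ : ℕ → Pt → Pt → ℤ
  stepSumQ n t r = ∑ (steps S) (λ s → + countQ S n (r +ₚ s) t)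

  countQ-suc : ∀ n t r → + countQ S (suc n) r t ≡ (if inQ r then stepSumQ n t r else 0ℤ)
  countQ-suc n t r = trans (count-words-suc _ (steps S) n)
    (trans (∑-cong (steps S) (λ s → count-guard (inQ r) (confinedQ (r +ₚ s))
                                      (λ w → endpoint (r +ₚ s) w ==ₚ t) (words (steps S) n)))
           (∑-if (inQ r) (steps S) _))

  countQ-outside : ∀ n t {r} → inQ r ≡ false → + countQ S n r t ≡ 0ℤ
  countQ-outside zero    t {r} r∉Q =
    cong +_ (trans (countQ-zero t r) (cong (λ c → if c ∧ (r ==ₚ t) then 1 else 0) r∉Q))
  countQ-outside (suc n) t {r} r∉Q =
    trans (countQ-suc n t r) (cong (λ c → if c then stepSumQ n t r else 0ℤ) r∉Q)

  ∑-reflectˣ : ∀ f → ∑ (steps S) (f ∘ negateˣ) ≡ ∑ (steps S) f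
  ∑-reflectˣ f = ∑-reindex f (steps-symmetricˣ S)

  ∑-reflectʸ : ∀ f → ∑ (steps S) (f ∘ negateʸ) ≡ ∑ (steps S) f
  ∑-reflectʸ f = ∑-reindex f (steps-symmetricʸ S)

  stepSumQ-leftOf : ∀ n t k y → stepSumQ n t (-[1+ suc k ] , y) ≡ 0ℤ
  stepSumQ-leftOf n t k y = ∑-zero (All.map vanish (steps-small S))
    where
    vanish : ∀ {s} → Small s → + countQ S n ((-[1+ suc k ] , y) +ₚ s) t ≡ 0ℤ
    vanish (c≤1 , _) = countQ-outside n t (cong (_∧ _) (far+step≱0 k c≤1))

  stepSumQ-below : ∀ n t x k → stepSumQ n t (x , -[1+ suc k ]) ≡ 0ℤ
  stepSumQ-below n t x k = ∑-zero (All.map vanish (steps-small S))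
    where
    vanish : ∀ {s} → Small s → + countQ S n ((x , -[1+ suc k ]) +ₚ s) t ≡ 0ℤ
    vanish {c , _} (_ , d≤1) =
      countQ-outside n t (trans (cong ((0ℤ ≤ᵇ (x + c)) ∧_) (far+step≱0 k d≤1)) (∧-zeroʳ _))

  countQ-suc-leftOf : ∀ n t k y →
    + countQ S (suc n) (-[1+ suc k ] , y) t ≡ stepSumQ n t (-[1+ suc k ] , y)
  countQ-suc-leftOf n t k y = trans (countQ-outside (suc n) t refl) (sym (stepSumQ-leftOf n t k y))

  countQ-suc-below : ∀ n t x k →
    + countQ S (suc n) (x , -[1+ suc k ]) t ≡ stepSumQ n t (x , -[1+ suc k ])
  countQ-suc-below n t x k =
    trans (countQ-outside (suc n) t (∧-zeroʳ _)) (sym (stepSumQ-below n t x k))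

  signedC signedQ : ℕ → Pt → Pt → ℤ
  signedC n t p = + countC S n p t - + countC S n p (σˣ t) - + countC S n p (σʸ t)
  signedQ n t p = + countQ S n p t - + countQ S n (σˣ p) t - + countQ S n (σʸ p) t

  signedQ-outside : ∀ n t {p} → inQ p ≡ false → inQ (σˣ p) ≡ false → inQ (σʸ p) ≡ false →
    signedQ n t p ≡ 0ℤ
  signedQ-outside n t p∉Q σˣp∉Q σʸp∉Q = cong₂ _-_
    (cong₂ _-_ (countQ-outside n t p∉Q) (countQ-outside n t σˣp∉Q)) (countQ-outside n t σʸp∉Q)

  signedQ-forbidden : ∀ n t {p} p' → T (forbidden p p') → signedQ n t p' ≡ 0ℤ
  signedQ-forbidden n t {p} p' f with forbidden-target {p} {p'} f
  ... | inj₁ refl = signedQ-outside n t refl refl refl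
  ... | inj₂ refl = signedQ-outside n t refl refl refl

  -- On the lines x = -1 and y = -1 one reflection fixes p, and the two equal terms cancel.
  signedQ-suc : ∀ n t p → signedQ (suc n) t p
    ≡ (if inC p then stepSumQ n t p - stepSumQ n t (σˣ p) - stepSumQ n t (σʸ p) else 0ℤ)
  signedQ-suc n t (+ m , + m') = cong₂ _-_
    (cong₂ _-_ (countQ-suc n t (+ m , + m')) (countQ-suc-leftOf n t m (+ m')))
    (countQ-suc-below n t (+ m) m')
  signedQ-suc n t (+ m , -[1+ zero ]) = begin
    Q' p - Q' (σˣ p) - Q' p                 ≡⟨ i-j-i≡-j (Q' p) (Q' (σˣ p)) ⟩
    - Q' (σˣ p)                              ≡⟨ cong -_ (countQ-suc-leftOf n t m -1ℤ) ⟩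
    - stepSumQ n t (σˣ p)                    ≡⟨ i-j-i≡-j (stepSumQ n t p) (stepSumQ n t (σˣ p)) ⟨
    stepSumQ n t p - stepSumQ n t (σˣ p) - stepSumQ n t p ∎
    where
    open ≡-Reasoning
    p : Pt
    p = (+ m , -1ℤ)
    Q' : Pt → ℤ
    Q' r = + countQ S (suc n) r t
  signedQ-suc n t (+ m , -[1+ suc k ]) = cong₂ _-_
    (cong₂ _-_ (countQ-suc-below n t (+ m) k) (countQ-suc-leftOf n t m -[1+ suc k ]))
    (countQ-suc n t (+ m , + k))
  signedQ-suc n t (-[1+ zero ] , + m') = begin
    Q' p - Q' p - Q' (σʸ p)                  ≡⟨ i-i-j≡-j (Q' p) (Q' (σʸ p)) ⟩
    - Q' (σʸ p)                              ≡⟨ cong -_ (countQ-suc-below n t -1ℤ m') ⟩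
    - stepSumQ n t (σʸ p)                    ≡⟨ i-i-j≡-j (stepSumQ n t p) (stepSumQ n t (σʸ p)) ⟨
    stepSumQ n t p - stepSumQ n t p - stepSumQ n t (σʸ p) ∎
    where
    open ≡-Reasoning
    p : Pt
    p = (-1ℤ , + m')
    Q' : Pt → ℤ
    Q' r = + countQ S (suc n) r t
  signedQ-suc n t (-[1+ suc k ] , + m') = cong₂ _-_
    (cong₂ _-_ (countQ-suc-leftOf n t k (+ m')) (countQ-suc n t (+ k , + m')))
    (countQ-suc-below n t -[1+ suc k ] m')
  signedQ-suc n t (-[1+ a ] , -[1+ b ]) = signedQ-outside (suc n) t refl (∧-zeroʳ _) refl

  ∑-signedQ : ∀ n t p → ∑ (steps S) (λ s → signedQ n t (p +ₚ s))
    ≡ stepSumQ n t p - stepSumQ n t (σˣ p) - stepSumQ n t (σʸ p)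
  ∑-signedQ n t p = begin
    ∑ L (λ s → Q (p +ₚ s) - Q (σˣ (p +ₚ s)) - Q (σʸ (p +ₚ s)))
      ≡⟨ ∑-⊖ L _ _ ⟩
    ∑ L (λ s → Q (p +ₚ s) - Q (σˣ (p +ₚ s))) - ∑ L (λ s → Q (σʸ (p +ₚ s)))
      ≡⟨ cong (_- ∑ L (λ s → Q (σʸ (p +ₚ s)))) (∑-⊖ L _ _) ⟩
    stepSumQ n t p - ∑ L (λ s → Q (σˣ (p +ₚ s))) - ∑ L (λ s → Q (σʸ (p +ₚ s)))
      ≡⟨ cong₂ (λ u v → stepSumQ n t p - u - v) reflectedˣ reflectedʸ ⟩
    stepSumQ n t p - stepSumQ n t (σˣ p) - stepSumQ n t (σʸ p) ∎
    where
    open ≡-Reasoning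
    L : List Pt
    L = steps S
    Q : Pt → ℤ
    Q r = + countQ S n r t
    reflectedˣ : ∑ L (λ s → Q (σˣ (p +ₚ s))) ≡ stepSumQ n t (σˣ p)
    reflectedˣ = trans (∑-cong L (λ s → cong Q (σˣ-+ₚ p s))) (∑-reflectˣ (λ s → Q (σˣ p +ₚ s)))
    reflectedʸ : ∑ L (λ s → Q (σʸ (p +ₚ s))) ≡ stepSumQ n t (σʸ p)
    reflectedʸ = trans (∑-cong L (λ s → cong Q (σʸ-+ₚ p s))) (∑-reflectʸ (λ s → Q (σʸ p +ₚ s)))

  signedQ-transfer : ∀ n t → signedQ (suc n) t ≗ transferC (signedQ n t)
  signedQ-transfer n t p = begin
    signedQ (suc n) t p
      ≡⟨ signedQ-suc n t p ⟩
    (if inC p then stepSumQ n t p - stepSumQ n t (σˣ p) - stepSumQ n t (σʸ p) else 0ℤ)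
      ≡⟨ cong (λ z → if inC p then z else 0ℤ) (∑-signedQ n t p) ⟨
    (if inC p then ∑ (steps S) (λ s → signedQ n t (p +ₚ s)) else 0ℤ)
      ≡⟨ transferC-vanishing (signedQ n t) p (signedQ-forbidden n t {p}) ⟨
    transferC (signedQ n t) p ∎
    where open ≡-Reasoning

  signedC-transfer : ∀ n t → signedC (suc n) t ≗ transferC (signedC n t)
  signedC-transfer n t p = begin
    signedC (suc n) t p
      ≡⟨ cong₂ _-_ (cong₂ _-_ (countC-suc n t p) (countC-suc n (σˣ t) p)) (countC-suc n (σʸ t) p) ⟩
    transferC (C t) p - transferC (C (σˣ t)) p - transferC (C (σʸ t)) p
      ≡⟨ cong (_- transferC (C (σʸ t)) p) (transferC-⊖ (C t) (C (σˣ t)) p) ⟨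
    transferC (λ p' → C t p' - C (σˣ t) p') p - transferC (C (σʸ t)) p
      ≡⟨ transferC-⊖ (λ p' → C t p' - C (σˣ t) p') (C (σʸ t)) p ⟨
    transferC (signedC n t) p ∎
    where
    open ≡-Reasoning
    C : Pt → Pt → ℤ
    C t' p' = + countC S n p' t'

  signed-initial : ∀ i j → signedC 0 (+ i , + j) ≗ signedQ 0 (+ i , + j)
  signed-initial i j p = cong₂ _-_
    (cong₂ _-_ (agree t p _ refl) (agree (σˣ t) (σˣ p) _ (==ₚ-σˣ p t)))
    (agree (σʸ t) (σʸ p) _ (==ₚ-σʸ p t))
    where
    t : Pt
    t = (+ i , + j)
    agree : ∀ t' p' → T (inC t') → (p ==ₚ t') ≡ (p' ==ₚ t) → + countC S 0 p t' ≡ + countQ S 0 p' t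
    agree t' p' t'∈C same = cong +_ (begin
      countC S 0 p t'                          ≡⟨ countC-zero t' p ⟩
      (if inC p ∧ (p ==ₚ t') then 1 else 0)    ≡⟨ cong (λ b → if b then 1 else 0) indicators-agree ⟩
      (if inQ p' ∧ (p' ==ₚ t) then 1 else 0)   ≡⟨ countQ-zero t p' ⟨
      countQ S 0 p' t                          ∎)
      where
      open ≡-Reasoning
      indicators-agree : inC p ∧ (p ==ₚ t') ≡ inQ p' ∧ (p' ==ₚ t)
      indicators-agree = trans (∧-==ₚ inC t'∈C p) (trans same (sym (∧-==ₚ inQ _ p')))

  signedC≗signedQ : ∀ n i j → signedC n (+ i , + j) ≗ signedQ n (+ i , + j)
  signedC≗signedQ n i j = transferC-unique (λ n → signedC n (+ i , + j)) (λ n → signedQ n (+ i , + j))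
    (λ n → signedC-transfer n (+ i , + j)) (λ n → signedQ-transfer n (+ i , + j)) (signed-initial i j) n

  countC-reflection : ∀ n i j p → + countC S n p (+ i , + j)
    ≡ (+ countC S n p (-[1+ suc i ] , + j) + + countC S n p (+ i , -[1+ suc j ])) + signedQ n (+ i , + j) p
  countC-reflection n i j p = trans
    (i≡[j+k]+[i-j-k] (+ countC S n p (+ i , + j)) (+ countC S n p (-[1+ suc i ] , + j))
                     (+ countC S n p (+ i , -[1+ suc j ])))
    (cong (λ z → + countC S n p (-[1+ suc i ] , + j) + + countC S n p (+ i , -[1+ suc j ]) + z)
          (signedC≗signedQ n i j p))

  signedQ-quadrant : ∀ n t {a b} → 0ℤ ≤ a → 0ℤ ≤ b → signedQ n t (a , b) ≡ + countQ S n (a , b) t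
  signedQ-quadrant n t {+ m} {+ m'} (+≤+ _) (+≤+ _) =
    trans (cong₂ _-_ (cong (λ z → + countQ S n (+ m , + m') t - z) (countQ-outside n t refl))
                     (countQ-outside n t refl))
          (trans (ℤ.+-identityʳ _) (ℤ.+-identityʳ _))

  signedQ-edge : ∀ n t {a b} → a ≡ -1ℤ ⊎ b ≡ -1ℤ → signedQ n t (a , b) ≡ 0ℤ
  signedQ-edge n t (inj₁ refl) = signedQ-outside n t refl refl refl
  signedQ-edge n t (inj₂ refl) = signedQ-outside n t (∧-zeroʳ _) (∧-zeroʳ _) (∧-zeroʳ _)

  signedQ-leftOf : ∀ n t {a b} → a < -1ℤ → signedQ n t (a , b) ≡ - + countQ S n (mirror a , b) t
  signedQ-leftOf n t { -[1+ suc k ]} {b} (-<- _) =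
    trans (cong₂ _-_ (cong (_- + countQ S n (+ k , b) t) (countQ-outside n t refl))
                     (countQ-outside n t refl))
          (trans (ℤ.+-identityʳ _) (ℤ.+-identityˡ _))

  signedQ-below : ∀ n t {a b} → b < -1ℤ → signedQ n t (a , b) ≡ - + countQ S n (a , mirror b) t
  signedQ-below n t { b = -[1+ suc k ]} (-<- _) =
    trans (cong₂ _-_ (cong₂ _-_ (countQ-outside n t (∧-zeroʳ _)) (countQ-outside n t (∧-zeroʳ _)))
                     refl)
          (ℤ.+-identityˡ _)

-- The start point need not lie in 𝒞: outside 𝒞 both sides vanish.
proposition12 : (S : StepSet) (a b : ℤ) → T (inC (a , b)) →
    (n i j : ℕ) →
    let lhs = + countC S n (a , b) (+ i , + j)
        rest = + countC S n (a , b) (-[1+ suc i ] , + j)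
             + + countC S n (a , b) (+ i , -[1+ suc j ])
    in ((0ℤ ≤ a) → (0ℤ ≤ b) → lhs ≡ rest + + countQ S n (a , b) (+ i , + j))
     × ((a ≡ -1ℤ ⊎ b ≡ -1ℤ) → lhs ≡ rest)
     × ((a < -1ℤ) → lhs ≡ rest - + countQ S n (- a - + 2 , b) (+ i , + j))
     × ((b < -1ℤ) → lhs ≡ rest - + countQ S n (a , - b - + 2) (+ i , + j))
proposition12 S a b _ n i j =
    (λ 0≤a 0≤b → reflection (signedQ-quadrant S n t 0≤a 0≤b))
  , (λ on-edge → trans (reflection (signedQ-edge S n t on-edge)) (ℤ.+-identityʳ _))
  , (λ a<-1 → reflection (trans (signedQ-leftOf S n t a<-1)
                                (cong (λ x → - + countQ S n (x , b) t) (mirror-≡ a))))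
  , (λ b<-1 → reflection (trans (signedQ-below S n t b<-1)
                                (cong (λ y → - + countQ S n (a , y) t) (mirror-≡ b))))
  where
  t : Pt
  t = (+ i , + j)
  reflection : ∀ {r} → signedQ S n t (a , b) ≡ r →
    + countC S n (a , b) t ≡ (+ countC S n (a , b) (σˣ t) + + countC S n (a , b) (σʸ t)) + r
  reflection refl = countC-reflection S n i j (a , b)
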